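{- Let $G$ be a simple graph, $F\subseteq E(G)$, and $k\ge\Delta(G)$ an integer. Suppose $G$ has a $k$-edge-coloring in which all edges of $F$ receive pairwise distinct colors. Then $G$ has a $k$-edge-coloring $\varphi$ in which all edges of $F$ receive pairwise distinct colors and such that for all distinct $i,j\in\{1,\dots,k\}$, $$\big|\,|\overline{\varphi}^{ -1}(i)|-|\overline{\varphi}^{ -1}(j)|\,\big|\le 5 .$$
   Context: A $k$-edge-coloring assigns colors from $\{1,\dots,k\}$ to the edges so that adjacent edges get different colors. For a $k$-edge-coloring $\varphi$ and a color $i$, $\overline{\varphi}^{ -1}(i)$ denotes the set of vertices of $G$ at which color $i$ is missing, i.e., vertices not incident with any edge colored $i$ under $\varphi$. -}

module Defs where

open import Data.Nat using (ℕ; _≤_)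
open import Data.Bool using (Bool; true; false; T)
open import Data.Fin using (Fin; _≟_)
open import Data.Fin.Properties using (all?)
open import Data.List using (List; length; filter; allFin)
open import Data.Product using (_×_)
open import Data.Sum using (_⊎_)
open import Relation.Binary.PropositionalEquality using (_≡_; _≢_)
open import Relation.Nullary using (Dec; ¬_; ¬?)
open import Relation.Nullary.Decidable using (_→-dec_)
open import Data.Bool.Properties using () renaming (_≟_ to _≟ᵇ_)

record Graph (n : ℕ) : Set where
  field
    adj    : Fin n → Fin n → Bool
    sym    : ∀ u v → adj u v ≡ adj v u
    irrefl : ∀ v → adj v v ≡ false
open Graph public

Adj : ∀ {n} → Graph n → Fin n → Fin n → Set
Adj G u v = adj G u v ≡ true

degree : ∀ {n} → Graph n → Fin n → ℕ
degree {n} G v = length (filter (λ u → adj G v u ≟ᵇ true) (allFin n))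

MaxDegree≤ : ∀ {n} → Graph n → ℕ → Set
MaxDegree≤ G k = ∀ v → degree G v ≤ k

record EdgeSubset {n : ℕ} (G : Graph n) : Set where
  field
    inF    : Fin n → Fin n → Bool
    symF   : ∀ u v → inF u v ≡ inF v u
    sub    : ∀ u v → inF u v ≡ true → Adj G u v
open EdgeSubset public

-- An edge colouring assigns to every ordered pair a colour; only values on
-- edges matter, and it must be symmetric on edges (so it colours the edge uv).
IsEdgeColoring : ∀ {n} (G : Graph n) (k : ℕ) → (Fin n → Fin n → Fin k) → Set
IsEdgeColoring G k c =
  (∀ u v → Adj G u v → c u v ≡ c v u) ×
  (∀ u v w → Adj G u v → Adj G u w → v ≢ w → c u v ≢ c u w)

RainbowOn : ∀ {n} {G : Graph n} {k : ℕ} → EdgeSubset G → (Fin n → Fin n → Fin k) → Set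
RainbowOn {n} F c = ∀ (u v x y : Fin n) → inF F u v ≡ true → inF F x y ≡ true →
  c u v ≡ c x y → (u ≡ x × v ≡ y) ⊎ (u ≡ y × v ≡ x)

Missing : ∀ {n k} (G : Graph n) → (Fin n → Fin n → Fin k) → Fin k → Fin n → Set
Missing G c i v = ∀ u → Adj G v u → ¬ (c v u ≡ i)

missing? : ∀ {n k} (G : Graph n) (c : Fin n → Fin n → Fin k) (i : Fin k) (v : Fin n) →
  Dec (Missing G c i v)
missing? G c i v = all? (λ u → (adj G v u ≟ᵇ true) →-dec ¬? (c v u ≟ i))

-- |φ̄⁻¹(i)| : number of vertices at which colour i is missing
missingCount : ∀ {n k} (G : Graph n) → (Fin n → Fin n → Fin k) → Fin k → ℕ
missingCount {n} G c i = length (filter (missing? G c i) (allFin n))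

{-# OPTIONS --safe #-}
-- Write mₐ for the number of vertices missing colour a. The edges of colours i and j
-- form two matchings I and J. Each component of I ∪ J that is a path with both end
-- edges in J has two ends missing i but not j, and no other component has more
-- vertices missing i than missing j. So if m_j + 6 ≤ m_i there are at least three
-- such paths; as F is rainbow, at most two of them carry an edge of F
-- (the one of colour i and the one of colour j). Swapping i and j along another one
-- keeps the colouring proper and F rainbow, lowers m_i by 2 and raises m_j by 2, and
-- therefore strictly decreases Σₐ mₐ². Repeating the swap ends in a colouring whose
-- missing counts differ pairwise by at most 5.
module Submission where

open import Data.Bool using (Bool; true; false; if_then_else_)
open import Data.Bool.Properties using () renaming (_≟_ to _≟ᵇ_)
open import Data.Empty using (⊥-elim)
open import Data.Fin using (Fin; zero; suc; _≟_; punchIn)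
open import Data.Fin.Permutation.Components using (transpose; transpose-inverse)
open import Data.Fin.Properties using (punchInᵢ≢i; any?)
open import Data.Fin.Subset using (Subset; _∈_; _∉_; ⁅_⁆; _∪_)
open import Data.Fin.Subset.Properties using (_∈?_; x∈⁅x⁆; x∈⁅y⁆⇒x≡y; x∈p∪q⁺; x∈p∪q⁻)
open import Data.List using (List; []; _∷_; _++_; length; filter; tabulate; map)
open import Data.List.Properties using (length-map; length-removeAt′; length-++)
open import Data.List.Relation.Unary.All as All using (All)
open import Data.List.Relation.Unary.All.Properties using (¬Any⇒All¬; ─⁻; map⁻; ++⁻ˡ; ++⁻ʳ)
open import Data.List.Relation.Unary.Any as Any using (Any; _─_)
open import Data.List.Relation.Unary.Any.Properties using (lookup-result)
open import Data.Maybe using (Maybe; just; nothing; is-just; is-nothing)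
open import Data.Maybe.Properties using (just-injective)
open import Data.Nat using (ℕ; zero; suc; _+_; _*_; _≤_; _<_; _≤?_; ∣_-_∣; z≤n; s≤s)
open import Data.Nat.Properties hiding (_≟_)
open import Data.Nat.Tactic.RingSolver using (solve-∀)
open import Algebra.Properties.CommutativeMonoid.Sum +-0-commutativeMonoid
  using (sum; sum-cong-≗; sum-remove)
open import Data.Product using (Σ; ∃; ∃₂; _×_; _,_; proj₁; proj₂)
open import Data.Sum using (_⊎_; inj₁; inj₂)
open import Data.Vec.Functional using (removeAt; updateAt)
open import Data.Vec.Functional.Properties using (updateAt-updates; updateAt-minimal)
open import Function using (_∘_; const; case_of_)
open import Function.Bundles using (mk⇔)
open import Relation.Binary.PropositionalEquality
  using (_≡_; _≢_; refl; sym; trans; cong; cong₂; subst; module ≡-Reasoning)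
open import Relation.Nullary using (Dec; yes; no; ¬_; does)
open import Relation.Nullary.Decidable using (dec-true; dec-false; does-⇔; _×-dec_)
open import Relation.Unary using (Decidable)

open import Defs hiding (sym)

sum-update : ∀ {n} (f g : Fin n → ℕ) (a : Fin n) → (∀ x → x ≢ a → f x ≡ g x) →
  sum f + g a ≡ sum g + f a
sum-update {suc n} f g a f≗g = begin
  sum f + g a                     ≡⟨ cong (_+ g a) (sum-remove {i = a} f) ⟩
  f a + sum (removeAt f a) + g a  ≡⟨ cong (λ s → f a + s + g a) (sum-cong-≗ f≗g-off-a) ⟩
  f a + sum (removeAt g a) + g a  ≡⟨ exchange (f a) _ (g a) ⟩
  g a + sum (removeAt g a) + f a  ≡⟨ cong (_+ f a) (sum-remove {i = a} g) ⟨
  sum g + f a                     ∎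
  where
  open ≡-Reasoning
  f≗g-off-a : ∀ x → removeAt f a x ≡ removeAt g a x
  f≗g-off-a x = f≗g (punchIn a x) (punchInᵢ≢i a x)
  exchange : ∀ x y z → x + y + z ≡ z + y + x
  exchange = solve-∀

sum-update₂ : ∀ {n} (f g : Fin n → ℕ) {a b : Fin n} → a ≢ b →
  (∀ x → x ≢ a → x ≢ b → f x ≡ g x) →
  sum f + g a + g b ≡ sum g + f a + f b
sum-update₂ f g {a} {b} a≢b f≗g = begin
  sum f + g a + g b  ≡⟨ cong (λ y → sum f + y + g b) (updateAt-updates a f) ⟨
  sum f + h a + g b  ≡⟨ cong (_+ g b) (sum-update f h a f≗h) ⟩
  sum h + f a + g b  ≡⟨ exchange (sum h) (f a) (g b) ⟩
  sum h + g b + f a  ≡⟨ cong (_+ f a) (sum-update h g b h≗g) ⟩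
  sum g + h b + f a  ≡⟨ cong (λ y → sum g + y + f a) (updateAt-minimal b a f (a≢b ∘ sym)) ⟩
  sum g + f b + f a  ≡⟨ exchange (sum g) (f b) (f a) ⟩
  sum g + f a + f b  ∎
  where
  open ≡-Reasoning
  h : Fin _ → ℕ
  h = updateAt f a (const (g a))
  f≗h : ∀ x → x ≢ a → f x ≡ h x
  f≗h x x≢a = sym (updateAt-minimal x a f x≢a)
  h≗g : ∀ x → x ≢ b → h x ≡ g x
  h≗g x x≢b with x ≟ a
  ... | yes refl = updateAt-updates a f
  ... | no x≢a   = trans (updateAt-minimal x a f x≢a) (f≗g x x≢a x≢b)
  exchange : ∀ x y z → x + y + z ≡ x + z + y
  exchange = solve-∀

sum-<⇒∃-< : ∀ {n} (f g : Fin n → ℕ) → sum f < sum g → ∃ λ x → f x < g x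
sum-<⇒∃-< {suc n} f g Σf<Σg with f zero <? g zero
... | yes f₀<g₀ = zero , f₀<g₀
... | no  f₀≮g₀ =
  let x , fx<gx = sum-<⇒∃-< (f ∘ suc) (g ∘ suc) (+-cancelˡ-< (g zero) _ _ tail<) in suc x , fx<gx
  where
  tail< : g zero + sum (f ∘ suc) < g zero + sum (g ∘ suc)
  tail< = ≤-<-trans (+-monoˡ-≤ _ (≮⇒≥ f₀≮g₀)) Σf<Σg

indicator : Bool → ℕ
indicator true  = 1
indicator false = 0

count : ∀ {n} → (Fin n → Bool) → ℕ
count p = sum (indicator ∘ p)

count-<⇒∃ : ∀ {n} (p q : Fin n → Bool) → count p < count q →
  ∃ λ x → p x ≡ false × q x ≡ true
count-<⇒∃ p q cp<cq with sum-<⇒∃-< (indicator ∘ p) (indicator ∘ q) cp<cq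
... | x , px<qx with p x in px | q x in qx
...   | false | true  = x , px , qx
...   | false | false = ⊥-elim (<-irrefl refl px<qx)
...   | true  | true  = ⊥-elim (<-irrefl refl px<qx)
...   | true  | false = ⊥-elim (<⇒≱ px<qx z≤n)

count-remove₂ : ∀ {n} {p q : Fin n → Bool} {a b : Fin n} → a ≢ b →
  (∀ x → x ≢ a → x ≢ b → p x ≡ q x) →
  p a ≡ true → p b ≡ true → q a ≡ false → q b ≡ false → count p ≡ count q + 2
count-remove₂ {p = p} {q} {a} {b} a≢b p≗q pa pb qa qb = begin
  count p                                      ≡⟨ trans (+-identityʳ _) (+-identityʳ _) ⟨
  count p + 0 + 0                              ≡⟨ cong₂ (count p +ᵢ_+ᵢ_) qa qb ⟨
  count p + indicator (q a) + indicator (q b)  ≡⟨ sum-update₂ _ _ a≢b p≗q′ ⟩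
  count q + indicator (p a) + indicator (p b)  ≡⟨ cong₂ (count q +ᵢ_+ᵢ_) pa pb ⟩
  count q + 1 + 1                              ≡⟨ +-assoc (count q) 1 1 ⟩
  count q + 2                                  ∎
  where
  open ≡-Reasoning
  _+ᵢ_+ᵢ_ : ℕ → Bool → Bool → ℕ
  m +ᵢ x +ᵢ y = m + indicator x + indicator y
  p≗q′ : ∀ x → x ≢ a → x ≢ b → indicator (p x) ≡ indicator (q x)
  p≗q′ x x≢a x≢b = cong indicator (p≗q x x≢a x≢b)

length-filter-tabulate : ∀ {a ℓ} {A : Set a} {P : A → Set ℓ} (P? : Decidable P)
  {n} (g : Fin n → A) → length (filter P? (tabulate g)) ≡ count (does ∘ P? ∘ g)
length-filter-tabulate P? {zero} g = refl
length-filter-tabulate P? {suc n} g with does (P? (g zero))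
... | true  = cong suc (length-filter-tabulate P? (g ∘ suc))
... | false = length-filter-tabulate P? (g ∘ suc)

-- Matchings as partial involutions

pair : ∀ {n} → Fin n → Fin n → Subset n
pair a b = ⁅ a ⁆ ∪ ⁅ b ⁆

∈-pairˡ : ∀ {n} (a b : Fin n) → a ∈ pair a b
∈-pairˡ a b = x∈p∪q⁺ (inj₁ (x∈⁅x⁆ a))

∈-pairʳ : ∀ {n} (a b : Fin n) → b ∈ pair a b
∈-pairʳ a b = x∈p∪q⁺ (inj₂ (x∈⁅x⁆ b))

∈-pair⁻ : ∀ {n} {a b x : Fin n} → x ∈ pair a b → x ≡ a ⊎ x ≡ b
∈-pair⁻ {a = a} {b} x∈ with x∈p∪q⁻ ⁅ a ⁆ ⁅ b ⁆ x∈
... | inj₁ x∈a = inj₁ (x∈⁅y⁆⇒x≡y a x∈a)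
... | inj₂ x∈b = inj₂ (x∈⁅y⁆⇒x≡y b x∈b)

∉-pair : ∀ {n} {a b x : Fin n} → x ≢ a → x ≢ b → x ∉ pair a b
∉-pair x≢a x≢b x∈ with ∈-pair⁻ x∈
... | inj₁ x≡a = x≢a x≡a
... | inj₂ x≡b = x≢b x≡b

≡just⇒≢nothing : ∀ {A : Set} {m : Maybe A} {x : A} → m ≡ just x → m ≢ nothing
≡just⇒≢nothing refl ()

≡just-unique : ∀ {A : Set} {m : Maybe A} {x y : A} → m ≡ just x → m ≡ just y → x ≡ y
≡just-unique m≡x m≡y = just-injective (trans (sym m≡x) m≡y)

record Matching (n : ℕ) : Set where
  field
    partner        : Fin n → Maybe (Fin n)
    partner-sym    : ∀ {u w} → partner u ≡ just w → partner w ≡ just u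
    partner-irrefl : ∀ u → partner u ≢ just u
open Matching

unmatched matched : ∀ {n} → Matching n → ℕ
unmatched M = count (is-nothing ∘ partner M)
matched M = count (is-just ∘ partner M)

partner-≢ : ∀ {n} (M : Matching n) {a b} → partner M a ≡ just b → a ≢ b
partner-≢ M Ma≡b refl = partner-irrefl M _ Ma≡b

module _ {n} (M : Matching n) {a b : Fin n} (a~b : partner M a ≡ just b) where

  erasedPartner : Fin n → Maybe (Fin n)
  erasedPartner u = if does (u ∈? pair a b) then nothing else partner M u

  erasedPartner-∈ : ∀ {u} → u ∈ pair a b → erasedPartner u ≡ nothing
  erasedPartner-∈ {u} u∈ rewrite dec-true (u ∈? pair a b) u∈ = refl

  erasedPartner-∉ : ∀ {u} → u ∉ pair a b → erasedPartner u ≡ partner M u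
  erasedPartner-∉ {u} u∉ rewrite dec-false (u ∈? pair a b) u∉ = refl

  erasedPartner-matched : ∀ {u} → erasedPartner u ≢ nothing → u ∉ pair a b
  erasedPartner-matched u-matched u∈ = u-matched (erasedPartner-∈ u∈)

  removeEdge : Matching n
  removeEdge = record
    { partner        = erasedPartner
    ; partner-sym    = sym′
    ; partner-irrefl = λ u u~u → partner-irrefl M u (trans (sym (kept u~u)) u~u)
    }
    where
    kept : ∀ {u w} → erasedPartner u ≡ just w → erasedPartner u ≡ partner M u
    kept u~w = erasedPartner-∉ (erasedPartner-matched (≡just⇒≢nothing u~w))
    sym′ : ∀ {u w} → erasedPartner u ≡ just w → erasedPartner w ≡ just u
    sym′ {u} {w} u~w = trans (erasedPartner-∉ w∉) w~u
      where
      w~u : partner M w ≡ just u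
      w~u = partner-sym M (trans (sym (kept u~w)) u~w)
      u∉ : u ∉ pair a b
      u∉ = erasedPartner-matched (≡just⇒≢nothing u~w)
      w∉ : w ∉ pair a b
      w∉ w∈ with ∈-pair⁻ w∈
      ... | inj₁ refl = u∉ (subst (_∈ pair a b) (≡just-unique a~b w~u) (∈-pairʳ a b))
      ... | inj₂ refl = u∉ (subst (_∈ pair a b) (≡just-unique (partner-sym M a~b) w~u) (∈-pairˡ a b))

  removeEdge-agrees : ∀ {u} → partner removeEdge u ≢ nothing → partner M u ≡ partner removeEdge u
  removeEdge-agrees u-matched = sym (erasedPartner-∉ (erasedPartner-matched u-matched))

  unmatched-removeEdge : unmatched removeEdge ≡ unmatched M + 2
  unmatched-removeEdge = count-remove₂ (partner-≢ M a~b)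
    (λ x x≢a x≢b → cong is-nothing (erasedPartner-∉ (∉-pair x≢a x≢b)))
    (cong is-nothing (erasedPartner-∈ (∈-pairˡ a b)))
    (cong is-nothing (erasedPartner-∈ (∈-pairʳ a b)))
    (cong is-nothing a~b) (cong is-nothing (partner-sym M a~b))

  matched-removeEdge : matched M ≡ matched removeEdge + 2
  matched-removeEdge = count-remove₂ (partner-≢ M a~b)
    (λ x x≢a x≢b → cong is-just (sym (erasedPartner-∉ (∉-pair x≢a x≢b))))
    (cong is-just a~b) (cong is-just (partner-sym M a~b))
    (cong is-just (erasedPartner-∈ (∈-pairˡ a b))) (cong is-just (erasedPartner-∈ (∈-pairʳ a b)))

-- Augmenting components of two matchings

freeᴵ-matchedᴶ : ∀ {n} (I J : Matching n) → unmatched J < unmatched I →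
  ∃₂ λ v₀ v₁ → partner I v₀ ≡ nothing × partner J v₀ ≡ just v₁
freeᴵ-matchedᴶ I J J<I with count-<⇒∃ _ _ J<I
... | v₀ , J-v₀ , I-v₀ with partner I v₀ in v₀-freeᴵ | partner J v₀ in v₀~v₁
...   | nothing | just v₁ = v₀ , v₁ , v₀-freeᴵ , v₀~v₁
...   | nothing | nothing = case J-v₀ of λ ()
...   | just _  | _       = case I-v₀ of λ ()

-- A union of components of I ∪ J without J-free vertices and with exactly two I-free
-- vertices, typically a path with J-edges at both ends: exchanging I and J on it
-- turns exactly its two ends from I-free into J-free.
record AugmentingComponent {n} (I J : Matching n) (forbidden : List (Fin n)) : Set where
  field
    vertices    : Subset n
    closedᴵ     : ∀ {u w} → u ∈ vertices → partner I u ≡ just w → w ∈ vertices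
    closedᴶ     : ∀ {u w} → u ∈ vertices → partner J u ≡ just w → w ∈ vertices
    start end   : Fin n
    start≢end   : start ≢ end
    start∈      : start ∈ vertices
    end∈        : end ∈ vertices
    start-freeᴵ : partner I start ≡ nothing
    end-freeᴵ   : partner I end ≡ nothing
    matchedᴵ    : ∀ {u} → u ∈ vertices → u ≢ start → u ≢ end → partner I u ≢ nothing
    matchedᴶ    : ∀ {u} → u ∈ vertices → partner J u ≢ nothing
    avoids      : All (_∉ vertices) forbidden
open AugmentingComponent

-- Each such component makes up 2 of the excess of I-free over J-free vertices, and
-- each forbidden vertex rules out at most one of them.
Surplus : ∀ {n} → Matching n → Matching n → List (Fin n) → Set
Surplus I J forbidden = unmatched J + 2 * length forbidden < unmatched I

reverse : ∀ {n} {I J : Matching n} {ts} → AugmentingComponent I J ts → AugmentingComponent I J ts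
reverse C = record C
  { start       = end C
  ; end         = start C
  ; start≢end   = start≢end C ∘ sym
  ; start∈      = end∈ C
  ; end∈        = start∈ C
  ; start-freeᴵ = end-freeᴵ C
  ; end-freeᴵ   = start-freeᴵ C
  ; matchedᴵ    = λ u∈ u≢end u≢start → matchedᴵ C u∈ u≢start u≢end
  }

transport : ∀ {n} {I J I′ J′ : Matching n} {ts ts′} (C : AugmentingComponent I′ J′ ts′) →
  (∀ {u} → u ∈ vertices C → partner I u ≡ partner I′ u) →
  (∀ {u} → u ∈ vertices C → partner J u ≡ partner J′ u) →
  All (_∉ vertices C) ts → AugmentingComponent I J ts
transport C agreeᴵ agreeᴶ avoid = record
  { vertices    = vertices C
  ; closedᴵ     = λ u∈ u~w → closedᴵ C u∈ (trans (sym (agreeᴵ u∈)) u~w)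
  ; closedᴶ     = λ u∈ u~w → closedᴶ C u∈ (trans (sym (agreeᴶ u∈)) u~w)
  ; start       = start C
  ; end         = end C
  ; start≢end   = start≢end C
  ; start∈      = start∈ C
  ; end∈        = end∈ C
  ; start-freeᴵ = trans (agreeᴵ (start∈ C)) (start-freeᴵ C)
  ; end-freeᴵ   = trans (agreeᴵ (end∈ C)) (end-freeᴵ C)
  ; matchedᴵ    = λ u∈ u≢s u≢e u-free →
                    matchedᴵ C u∈ u≢s u≢e (trans (sym (agreeᴵ u∈)) u-free)
  ; matchedᴶ    = λ u∈ u-free → matchedᴶ C u∈ (trans (sym (agreeᴶ u∈)) u-free)
  ; avoids      = avoid
  }

-- Induction on |J| from a J-edge v₀v₁ at an I-free vertex v₀. If v₁ is I-free the edge
-- is itself a component, usable unless v₀ or v₁ is forbidden; then it is deleted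
-- together with one forbidden vertex. If v₁v₂ ∈ I, both edges are deleted, which
-- contracts the path v₀v₁v₂ into its new end v₂, and forbidden v₀, v₁ become v₂.
module Grow {n} (I J : Matching n) {v₀ v₁ : Fin n}
  (v₀-freeᴵ : partner I v₀ ≡ nothing) (v₀~v₁ : partner J v₀ ≡ just v₁) where

  J′ : Matching n
  J′ = removeEdge J v₀~v₁

  v₁~v₀ : partner J v₁ ≡ just v₀
  v₁~v₀ = partner-sym J v₀~v₁

  module _ {I″ : Matching n} {ts} (C : AugmentingComponent I″ J′ ts) where

    off-pair : ∀ {u} → u ∈ vertices C → u ∉ pair v₀ v₁
    off-pair u∈ = erasedPartner-matched J v₀~v₁ (matchedᴶ C u∈)

    agreeᴶ : ∀ {u} → u ∈ vertices C → partner J u ≡ partner J′ u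
    agreeᴶ u∈ = removeEdge-agrees J v₀~v₁ (matchedᴶ C u∈)

  edgeComponent : ∀ {ts} → partner I v₁ ≡ nothing → All (_∉ pair v₀ v₁) ts →
    AugmentingComponent I J ts
  edgeComponent v₁-freeᴵ avoid = record
    { vertices    = pair v₀ v₁
    ; closedᴵ     = λ u∈ u~w → case trans (sym u~w) (freeᴵ u∈) of λ ()
    ; closedᴶ     = closedᴶ′
    ; start       = v₀
    ; end         = v₁
    ; start≢end   = partner-≢ J v₀~v₁
    ; start∈      = ∈-pairˡ v₀ v₁
    ; end∈        = ∈-pairʳ v₀ v₁
    ; start-freeᴵ = v₀-freeᴵ
    ; end-freeᴵ   = v₁-freeᴵ
    ; matchedᴵ    = λ u∈ u≢v₀ u≢v₁ → ⊥-elim (∉-pair u≢v₀ u≢v₁ u∈)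
    ; matchedᴶ    = matchedᴶ′
    ; avoids      = avoid
    }
    where
    freeᴵ : ∀ {u} → u ∈ pair v₀ v₁ → partner I u ≡ nothing
    freeᴵ u∈ with ∈-pair⁻ u∈
    ... | inj₁ refl = v₀-freeᴵ
    ... | inj₂ refl = v₁-freeᴵ
    closedᴶ′ : ∀ {u w} → u ∈ pair v₀ v₁ → partner J u ≡ just w → w ∈ pair v₀ v₁
    closedᴶ′ u∈ u~w with ∈-pair⁻ u∈
    ... | inj₁ refl rewrite ≡just-unique u~w v₀~v₁ = ∈-pairʳ v₀ v₁
    ... | inj₂ refl rewrite ≡just-unique u~w v₁~v₀ = ∈-pairˡ v₀ v₁
    matchedᴶ′ : ∀ {u} → u ∈ pair v₀ v₁ → partner J u ≢ nothing
    matchedᴶ′ u∈ with ∈-pair⁻ u∈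
    ... | inj₁ refl = ≡just⇒≢nothing v₀~v₁
    ... | inj₂ refl = ≡just⇒≢nothing v₁~v₀

  dropForbidden : ∀ {ts} (t∈ : Any (_∈ pair v₀ v₁) ts) →
    AugmentingComponent I J′ (ts ─ t∈) → AugmentingComponent I J ts
  dropForbidden t∈ C =
    transport C (λ _ → refl) (agreeᴶ C)
      (─⁻ t∈ (λ t∈C → off-pair C t∈C (lookup-result t∈)) (avoids C))

  module Contract {v₂ : Fin n} (v₁~v₂ : partner I v₁ ≡ just v₂) where

    I′ : Matching n
    I′ = removeEdge I v₁~v₂

    v₂~v₁ : partner I v₂ ≡ just v₁
    v₂~v₁ = partner-sym I v₁~v₂

    redirect : Fin n → Fin n
    redirect t = if does (t ∈? pair v₀ v₁) then v₂ else t

    module _ {ts} (C : AugmentingComponent I′ J′ (map redirect ts)) where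

      agreeᴵ : ∀ {u} → u ∈ vertices C → u ≢ v₂ → partner I u ≡ partner I′ u
      agreeᴵ u∈ u≢v₂ = sym (erasedPartner-∉ I v₁~v₂ (∉-pair u≢v₁ u≢v₂))
        where
        u≢v₁ : _ ≢ v₁
        u≢v₁ refl = off-pair C u∈ (∈-pairʳ v₀ v₁)

      liftFree : v₂ ∉ vertices C → AugmentingComponent I J ts
      liftFree v₂∉ = transport C (λ u∈ → agreeᴵ u∈ λ { refl → v₂∉ u∈ }) (agreeᴶ C)
        (All.map avoid (map⁻ (avoids C)))
        where
        avoid : ∀ {t} → redirect t ∉ vertices C → t ∉ vertices C
        avoid {t} r∉ with t ∈? pair v₀ v₁
        ... | yes t∈ = λ t∈C → off-pair C t∈C t∈
        ... | no  _  = r∉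

      module _ (start≡v₂ : start C ≡ v₂) where

        S : Subset n
        S = pair v₀ v₁ ∪ vertices C

        end≢v₂ : end C ≢ v₂
        end≢v₂ end≡v₂ = start≢end C (trans start≡v₂ (sym end≡v₂))

        ∈S⁻ : ∀ {u} → u ∈ S → u ≡ v₀ ⊎ u ≡ v₁ ⊎ u ∈ vertices C
        ∈S⁻ u∈ with x∈p∪q⁻ (pair v₀ v₁) (vertices C) u∈
        ... | inj₂ u∈C = inj₂ (inj₂ u∈C)
        ... | inj₁ u∈p with ∈-pair⁻ u∈p
        ...   | inj₁ u≡v₀ = inj₁ u≡v₀
        ...   | inj₂ u≡v₁ = inj₂ (inj₁ u≡v₁)

        v₂∈C : v₂ ∈ vertices C
        v₂∈C = subst (_∈ vertices C) start≡v₂ (start∈ C)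

        v₀∈S : v₀ ∈ S
        v₀∈S = x∈p∪q⁺ (inj₁ (∈-pairˡ v₀ v₁))
        v₁∈S : v₁ ∈ S
        v₁∈S = x∈p∪q⁺ (inj₁ (∈-pairʳ v₀ v₁))
        C⊆S : ∀ {u} → u ∈ vertices C → u ∈ S
        C⊆S u∈ = x∈p∪q⁺ (inj₂ u∈)

        closedᴵ′ : ∀ {u w} → u ∈ S → partner I u ≡ just w → w ∈ S
        closedᴵ′ {u} u∈ u~w with ∈S⁻ u∈
        ... | inj₁ refl = case trans (sym u~w) v₀-freeᴵ of λ ()
        ... | inj₂ (inj₁ refl) rewrite ≡just-unique u~w v₁~v₂ = C⊆S v₂∈C
        ... | inj₂ (inj₂ u∈C) with u ≟ v₂
        ...   | yes refl rewrite ≡just-unique u~w v₂~v₁ = v₁∈S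
        ...   | no u≢v₂ = C⊆S (closedᴵ C u∈C (trans (sym (agreeᴵ u∈C u≢v₂)) u~w))

        closedᴶ′ : ∀ {u w} → u ∈ S → partner J u ≡ just w → w ∈ S
        closedᴶ′ u∈ u~w with ∈S⁻ u∈
        ... | inj₁ refl rewrite ≡just-unique u~w v₀~v₁ = v₁∈S
        ... | inj₂ (inj₁ refl) rewrite ≡just-unique u~w v₁~v₀ = v₀∈S
        ... | inj₂ (inj₂ u∈C) = C⊆S (closedᴶ C u∈C (trans (sym (agreeᴶ C u∈C)) u~w))

        matchedᴵ′ : ∀ {u} → u ∈ S → u ≢ v₀ → u ≢ end C → partner I u ≢ nothing
        matchedᴵ′ {u} u∈ u≢v₀ u≢end with ∈S⁻ u∈
        ... | inj₁ u≡v₀ = ⊥-elim (u≢v₀ u≡v₀)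
        ... | inj₂ (inj₁ refl) = ≡just⇒≢nothing v₁~v₂
        ... | inj₂ (inj₂ u∈C) with u ≟ v₂
        ...   | yes refl = ≡just⇒≢nothing v₂~v₁
        ...   | no u≢v₂ = λ u-free →
          matchedᴵ C u∈C (λ u≡s → u≢v₂ (trans u≡s start≡v₂)) u≢end (trans (sym (agreeᴵ u∈C u≢v₂)) u-free)

        matchedᴶ′ : ∀ {u} → u ∈ S → partner J u ≢ nothing
        matchedᴶ′ u∈ with ∈S⁻ u∈
        ... | inj₁ refl = ≡just⇒≢nothing v₀~v₁
        ... | inj₂ (inj₁ refl) = ≡just⇒≢nothing v₁~v₀
        ... | inj₂ (inj₂ u∈C) = λ u-free →
          matchedᴶ C u∈C (trans (sym (agreeᴶ C u∈C)) u-free)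

        avoid : ∀ {t} → redirect t ∉ vertices C → t ∉ S
        avoid {t} r∉ t∈S with t ∈? pair v₀ v₁
        ... | yes _  = r∉ v₂∈C
        ... | no  t∉ with x∈p∪q⁻ (pair v₀ v₁) (vertices C) t∈S
        ...   | inj₁ t∈ = t∉ t∈
        ...   | inj₂ t∈C = r∉ t∈C

        liftThrough : AugmentingComponent I J ts
        liftThrough = record
          { vertices    = S
          ; closedᴵ     = closedᴵ′
          ; closedᴶ     = closedᴶ′
          ; start       = v₀
          ; end         = end C
          ; start≢end   = λ { refl → off-pair C (end∈ C) (∈-pairˡ v₀ v₁) }
          ; start∈      = v₀∈S
          ; end∈        = C⊆S (end∈ C)
          ; start-freeᴵ = v₀-freeᴵ
          ; end-freeᴵ   = trans (agreeᴵ (end∈ C) end≢v₂) (end-freeᴵ C)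
          ; matchedᴵ    = matchedᴵ′
          ; matchedᴶ    = matchedᴶ′
          ; avoids      = All.map avoid (map⁻ (avoids C))
          }

    surplus-contract : ∀ {ts} → Surplus I J ts → Surplus I′ J′ (map redirect ts)
    surplus-contract {ts} surplus = begin-strict
      unmatched J′ + 2 * length (map redirect ts)  ≡⟨ cong₂ (λ x l → x + 2 * l)
                                                        (unmatched-removeEdge J v₀~v₁) (length-map redirect ts) ⟩
      unmatched J + 2 + 2 * length ts              ≡⟨ exchange (unmatched J) 2 (2 * length ts) ⟩
      unmatched J + 2 * length ts + 2              <⟨ +-monoˡ-< 2 surplus ⟩
      unmatched I + 2                              ≡⟨ unmatched-removeEdge I v₁~v₂ ⟨
      unmatched I′                                 ∎
      where
      open ≤-Reasoning
      exchange : ∀ x y z → x + y + z ≡ x + z + y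
      exchange = solve-∀

    lift : ∀ {ts} → AugmentingComponent I′ J′ (map redirect ts) → AugmentingComponent I J ts
    lift C with v₂ ∈? vertices C
    ... | no v₂∉ = liftFree C v₂∉
    ... | yes v₂∈ with v₂ ≟ start C | v₂ ≟ end C
    ...   | yes v₂≡start | _ = liftThrough C (sym v₂≡start)
    ...   | no _ | yes v₂≡end = liftThrough (reverse C) (sym v₂≡end)
    ...   | no v₂≢start | no v₂≢end =
      ⊥-elim (matchedᴵ C v₂∈ v₂≢start v₂≢end (erasedPartner-∈ I v₁~v₂ (∈-pairʳ v₁ v₂)))

  J′-smaller : ∀ {fuel} → matched J < suc fuel → matched J′ < fuel
  J′-smaller J<fuel = <-≤-trans (m<m+n (matched J′) (s≤s z≤n))
    (subst (_≤ _) (matched-removeEdge J v₀~v₁) (≤-pred J<fuel))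

  surplus-drop : ∀ {ts} (t∈ : Any (_∈ pair v₀ v₁) ts) →
    Surplus I J ts → Surplus I J′ (ts ─ t∈)
  surplus-drop {ts} t∈ surplus = begin-strict
    unmatched J′ + 2 * length (ts ─ t∈)       ≡⟨ cong (_+ _) (unmatched-removeEdge J v₀~v₁) ⟩
    unmatched J + 2 + 2 * length (ts ─ t∈)    ≡⟨ +-*-suc (unmatched J) (length (ts ─ t∈)) ⟩
    unmatched J + 2 * suc (length (ts ─ t∈))  ≡⟨ cong (λ l → unmatched J + 2 * l)
                                                     (length-removeAt′ ts (Any.index t∈)) ⟨
    unmatched J + 2 * length ts               <⟨ surplus ⟩
    unmatched I                               ∎
    where
    open ≤-Reasoning
    +-*-suc : ∀ x l → x + 2 + 2 * l ≡ x + 2 * suc l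
    +-*-suc = solve-∀

  extend : ∀ {fuel ts} →
    (∀ {I J : Matching n} {ts} → matched J < fuel → Surplus I J ts → AugmentingComponent I J ts) →
    matched J < suc fuel → Surplus I J ts → AugmentingComponent I J ts
  extend {ts = ts} rec J<fuel surplus with partner I v₁ in v₁-I
  ... | just _ =
    Contract.lift v₁-I (rec (J′-smaller J<fuel) (Contract.surplus-contract v₁-I {ts} surplus))
  ... | nothing with Any.any? (_∈? pair v₀ v₁) ts
  ...   | no  t∉ = edgeComponent v₁-I (¬Any⇒All¬ ts t∉)
  ...   | yes t∈ = dropForbidden t∈ (rec (J′-smaller J<fuel) (surplus-drop t∈ surplus))

augmentingComponent : ∀ {n} fuel {I J : Matching n} {ts} →
  matched J < fuel → Surplus I J ts → AugmentingComponent I J ts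
augmentingComponent (suc fuel) {I} {J} J<fuel surplus
  with freeᴵ-matchedᴶ I J (≤-<-trans (m≤m+n _ _) surplus)
... | _ , _ , v₀-freeᴵ , v₀~v₁ =
  Grow.extend I J v₀-freeᴵ v₀~v₁ (augmentingComponent fuel) J<fuel surplus

-- Colour classes

Coloring : ℕ → ℕ → Set
Coloring n k = Fin n → Fin n → Fin k

Adj-sym : ∀ {n} (G : Graph n) {u w} → Adj G u w → Adj G w u
Adj-sym G {u} {w} uw = trans (Graph.sym G w u) uw

isMissing : ∀ {n k} → Graph n → Coloring n k → Fin k → Fin n → Bool
isMissing G c a u = does (missing? G c a u)

missingCount≡count : ∀ {n k} (G : Graph n) (c : Coloring n k) a →
  missingCount G c a ≡ count (isMissing G c a)
missingCount≡count G c a = length-filter-tabulate (missing? G c a) (λ u → u)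

module _ {n k} (G : Graph n) (c : Coloring n k) where

  coloredNeighbor? : ∀ a u → Dec (∃ λ w → Adj G u w × c u w ≡ a)
  coloredNeighbor? a u = any? (λ w → (adj G u w ≟ᵇ true) ×-dec (c u w ≟ a))

  colorPartner : Fin k → Fin n → Maybe (Fin n)
  colorPartner a u with coloredNeighbor? a u
  ... | yes (w , _) = just w
  ... | no  _       = nothing

  colorPartner-sound : ∀ {a u w} → colorPartner a u ≡ just w → Adj G u w × c u w ≡ a
  colorPartner-sound {a} {u} u~w with coloredNeighbor? a u
  colorPartner-sound refl | yes (_ , uw , uw-a) = uw , uw-a

  colorPartner-isMissing : ∀ a u → is-nothing (colorPartner a u) ≡ isMissing G c a u
  colorPartner-isMissing a u with coloredNeighbor? a u
  ... | yes (w , uw , uw-a) = sym (dec-false (missing? G c a u) λ a-missing → a-missing w uw uw-a)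
  ... | no  ∄               = sym (dec-true (missing? G c a u) λ w uw uw-a → ∄ (w , uw , uw-a))

  unmatched⇒isMissing : ∀ {a u} → colorPartner a u ≡ nothing → isMissing G c a u ≡ true
  unmatched⇒isMissing {a} {u} u-free = trans (sym (colorPartner-isMissing a u)) (cong is-nothing u-free)

  matched⇒¬isMissing : ∀ {a u} → colorPartner a u ≢ nothing → isMissing G c a u ≡ false
  matched⇒¬isMissing {a} {u} u-matched with colorPartner a u | colorPartner-isMissing a u
  ... | just _  | eq = sym eq
  ... | nothing | _  = ⊥-elim (u-matched refl)

module _ {n k} (G : Graph n) {c : Coloring n k} (proper : IsEdgeColoring G k c) where

  colorPartner-complete : ∀ {a u w} → Adj G u w → c u w ≡ a → colorPartner G c a u ≡ just w
  colorPartner-complete {a} {u} {w} uw uw-a with coloredNeighbor? G c a u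
  ... | no  ∄ = ⊥-elim (∄ (w , uw , uw-a))
  ... | yes (w′ , uw′ , uw′-a) with w ≟ w′
  ...   | yes refl = refl
  ...   | no  w≢w′ = ⊥-elim (proj₂ proper u w w′ uw uw′ w≢w′ (trans uw-a (sym uw′-a)))

  colorMatching : Fin k → Matching n
  colorMatching a = record
    { partner        = colorPartner G c a
    ; partner-sym    = λ u~w → let uw , uw-a = colorPartner-sound G c u~w in
                         colorPartner-complete (Adj-sym G uw) (trans (sym (proj₁ proper _ _ uw)) uw-a)
    ; partner-irrefl = λ u u~u →
                         case trans (sym (proj₁ (colorPartner-sound G c u~u))) (irrefl G u) of λ ()
    }

  missingCount≡unmatched : ∀ a → missingCount G c a ≡ unmatched (colorMatching a)
  missingCount≡unmatched a = trans (missingCount≡count G c a)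
    (sum-cong-≗ λ u → cong indicator (sym (colorPartner-isMissing G c a u)))

transpose-matchˡ : ∀ {k} (i j : Fin k) → transpose i j i ≡ j
transpose-matchˡ i j rewrite dec-true (i ≟ i) refl = refl

transpose-matchʳ : ∀ {k} (i j : Fin k) → transpose i j j ≡ i
transpose-matchʳ i j with j ≟ i
... | yes refl = refl
... | no  j≢i rewrite dec-true (j ≟ j) refl = refl

transpose-mismatch : ∀ {k} {i j x : Fin k} → x ≢ i → x ≢ j → transpose i j x ≡ x
transpose-mismatch {i = i} {j} {x} x≢i x≢j
  rewrite dec-false (x ≟ i) x≢i | dec-false (x ≟ j) x≢j = refl

transpose-injective : ∀ {k} (i j : Fin k) {x y} → transpose i j x ≡ transpose i j y → x ≡ y
transpose-injective i j {x} {y} eq =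
  trans (sym (transpose-inverse j i)) (trans (cong (transpose j i) eq) (transpose-inverse j i))

-- Kempe swaps

ColorClosed : ∀ {n k} → Graph n → Coloring n k → Fin k → Subset n → Set
ColorClosed G c a S = ∀ {u w} → u ∈ S → Adj G u w → c u w ≡ a → w ∈ S

kempeSwap : ∀ {n k} → Subset n → Fin k → Fin k → Coloring n k → Coloring n k
kempeSwap S i j c u w = if does (u ∈? S) then transpose i j (c u w) else c u w

module Kempe {n k} (G : Graph n) (S : Subset n) (i j : Fin k) (c : Coloring n k) where

  kempeSwap-∈ : ∀ {u w} → u ∈ S → kempeSwap S i j c u w ≡ transpose i j (c u w)
  kempeSwap-∈ {u} u∈ rewrite dec-true (u ∈? S) u∈ = refl

  kempeSwap-∉ : ∀ {u w} → u ∉ S → kempeSwap S i j c u w ≡ c u w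
  kempeSwap-∉ {u} u∉ rewrite dec-false (u ∈? S) u∉ = refl

  kempeSwap-fixes : ∀ {u w} → (u ∈ S → c u w ≢ i) → (u ∈ S → c u w ≢ j) →
    kempeSwap S i j c u w ≡ c u w
  kempeSwap-fixes {u} ≢i ≢j with u ∈? S
  ... | yes u∈ = transpose-mismatch (≢i u∈) (≢j u∈)
  ... | no  _  = refl

  kempeSwap-isEdgeColoring : IsEdgeColoring G k c →
    ColorClosed G c i S → ColorClosed G c j S → IsEdgeColoring G k (kempeSwap S i j c)
  kempeSwap-isEdgeColoring (c-sym , c-proper) closedᵢ closedⱼ = c′-sym , c′-proper
    where
    crossing-fixed : ∀ {u w} → u ∈ S → w ∉ S → Adj G u w → transpose i j (c u w) ≡ c u w
    crossing-fixed u∈ w∉ uw =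
      transpose-mismatch (λ uw-i → w∉ (closedᵢ u∈ uw uw-i)) (λ uw-j → w∉ (closedⱼ u∈ uw uw-j))
    c′-sym : ∀ u w → Adj G u w → kempeSwap S i j c u w ≡ kempeSwap S i j c w u
    c′-sym u w uw with u ∈? S | w ∈? S
    ... | yes _  | yes _  = cong (transpose i j) (c-sym u w uw)
    ... | no  _  | no  _  = c-sym u w uw
    ... | yes u∈ | no  w∉ = trans (crossing-fixed u∈ w∉ uw) (c-sym u w uw)
    ... | no  u∉ | yes w∈ = trans (c-sym u w uw) (sym (crossing-fixed w∈ u∉ (Adj-sym G uw)))
    c′-proper : ∀ u v w → Adj G u v → Adj G u w → v ≢ w →
      kempeSwap S i j c u v ≢ kempeSwap S i j c u w
    c′-proper u v w uv uw v≢w with u ∈? S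
    ... | yes _ = c-proper u v w uv uw v≢w ∘ transpose-injective i j
    ... | no  _ = c-proper u v w uv uw v≢w

  isMissing-kempeSwap-∈ : ∀ {a u} → u ∈ S →
    isMissing G (kempeSwap S i j c) a u ≡ isMissing G c (transpose j i a) u
  isMissing-kempeSwap-∈ {a} {u} u∈ =
    does-⇔ (mk⇔ to from) (missing? G (kempeSwap S i j c) a u) (missing? G c (transpose j i a) u)
    where
    to : Missing G (kempeSwap S i j c) a u → Missing G c (transpose j i a) u
    to a-missing w uw uw-a = a-missing w uw
      (trans (kempeSwap-∈ u∈) (trans (cong (transpose i j) uw-a) (transpose-inverse i j)))
    from : Missing G c (transpose j i a) u → Missing G (kempeSwap S i j c) a u
    from a-missing w uw uw-a = a-missing w uw
      (trans (sym (transpose-inverse j i)) (cong (transpose j i) (trans (sym (kempeSwap-∈ u∈)) uw-a)))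

  isMissing-kempeSwap-∉ : ∀ {a u} → u ∉ S →
    isMissing G (kempeSwap S i j c) a u ≡ isMissing G c a u
  isMissing-kempeSwap-∉ {a} {u} u∉ =
    does-⇔ (mk⇔ to from) (missing? G (kempeSwap S i j c) a u) (missing? G c a u)
    where
    to : Missing G (kempeSwap S i j c) a u → Missing G c a u
    to a-missing w uw uw-a = a-missing w uw (trans (kempeSwap-∉ u∉) uw-a)
    from : Missing G c a u → Missing G (kempeSwap S i j c) a u
    from a-missing w uw uw-a = a-missing w uw (trans (sym (kempeSwap-∉ u∉)) uw-a)

  missingCount-kempeSwap-other : ∀ {a} → a ≢ i → a ≢ j →
    missingCount G (kempeSwap S i j c) a ≡ missingCount G c a
  missingCount-kempeSwap-other {a} a≢i a≢j = begin
    missingCount G (kempeSwap S i j c) a  ≡⟨ missingCount≡count G _ a ⟩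
    count (isMissing G (kempeSwap S i j c) a)  ≡⟨ sum-cong-≗ (cong indicator ∘ unchanged) ⟩
    count (isMissing G c a)  ≡⟨ missingCount≡count G c a ⟨
    missingCount G c a  ∎
    where
    open ≡-Reasoning
    unchanged : ∀ u → isMissing G (kempeSwap S i j c) a u ≡ isMissing G c a u
    unchanged u = case u ∈? S of λ where
      (yes u∈) → trans (isMissing-kempeSwap-∈ u∈)
                       (cong (λ b → isMissing G c b u) (transpose-mismatch a≢j a≢i))
      (no  u∉) → isMissing-kempeSwap-∉ u∉

module SwapAlong {n k} (G : Graph n) {c : Coloring n k} (proper : IsEdgeColoring G k c) {i j : Fin k} {ts}
  (C : AugmentingComponent (colorMatching G proper i) (colorMatching G proper j) ts) where

  S : Subset n
  S = vertices C

  c′ : Coloring n k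
  c′ = kempeSwap S i j c

  open Kempe G S i j c public

  closedᵢ : ColorClosed G c i S
  closedᵢ u∈ uw uw-i = closedᴵ C u∈ (colorPartner-complete G proper uw uw-i)

  closedⱼ : ColorClosed G c j S
  closedⱼ u∈ uw uw-j = closedᴶ C u∈ (colorPartner-complete G proper uw uw-j)

  c′-isEdgeColoring : IsEdgeColoring G k c′
  c′-isEdgeColoring = kempeSwap-isEdgeColoring proper closedᵢ closedⱼ

  c-j-present : ∀ {u} → u ∈ S → isMissing G c j u ≡ false
  c-j-present u∈ = matched⇒¬isMissing G c (matchedᴶ C u∈)

  c-i-present : ∀ {u} → u ∈ S → u ≢ start C → u ≢ end C → isMissing G c i u ≡ false
  c-i-present u∈ u≢s u≢e = matched⇒¬isMissing G c (matchedᴵ C u∈ u≢s u≢e)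

  c-i-missing-start : isMissing G c i (start C) ≡ true
  c-i-missing-start = unmatched⇒isMissing G c (start-freeᴵ C)

  c-i-missing-end : isMissing G c i (end C) ≡ true
  c-i-missing-end = unmatched⇒isMissing G c (end-freeᴵ C)

  c′-i≡c-j : ∀ {u} → u ∈ S → isMissing G c′ i u ≡ isMissing G c j u
  c′-i≡c-j u∈ =
    trans (isMissing-kempeSwap-∈ u∈) (cong (λ b → isMissing G c b _) (transpose-matchʳ j i))

  c′-j≡c-i : ∀ {u} → u ∈ S → isMissing G c′ j u ≡ isMissing G c i u
  c′-j≡c-i u∈ =
    trans (isMissing-kempeSwap-∈ u∈) (cong (λ b → isMissing G c b _) (transpose-matchˡ j i))

  c′-i-present : ∀ {u} → u ∈ S → isMissing G c′ i u ≡ false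
  c′-i-present u∈ = trans (c′-i≡c-j u∈) (c-j-present u∈)

  missingCount-i : missingCount G c i ≡ missingCount G c′ i + 2
  missingCount-i = begin
    missingCount G c i            ≡⟨ missingCount≡count G c i ⟩
    count (isMissing G c i)       ≡⟨ count-remove₂ (start≢end C) unchanged c-i-missing-start c-i-missing-end
                                       (c′-i-present (start∈ C)) (c′-i-present (end∈ C)) ⟩
    count (isMissing G c′ i) + 2  ≡⟨ cong (_+ 2) (missingCount≡count G c′ i) ⟨
    missingCount G c′ i + 2       ∎
    where
    open ≡-Reasoning
    unchanged : ∀ x → x ≢ start C → x ≢ end C → isMissing G c i x ≡ isMissing G c′ i x
    unchanged x x≢s x≢e = case x ∈? S of λ where
      (yes x∈) → trans (c-i-present x∈ x≢s x≢e) (sym (c′-i-present x∈))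
      (no  x∉) → sym (isMissing-kempeSwap-∉ x∉)

  missingCount-j : missingCount G c′ j ≡ missingCount G c j + 2
  missingCount-j = begin
    missingCount G c′ j           ≡⟨ missingCount≡count G c′ j ⟩
    count (isMissing G c′ j)      ≡⟨ count-remove₂ (start≢end C) unchanged
                                       (trans (c′-j≡c-i (start∈ C)) c-i-missing-start)
                                       (trans (c′-j≡c-i (end∈ C)) c-i-missing-end)
                                       (c-j-present (start∈ C)) (c-j-present (end∈ C)) ⟩
    count (isMissing G c j) + 2   ≡⟨ cong (_+ 2) (missingCount≡count G c j) ⟨
    missingCount G c j + 2        ∎
    where
    open ≡-Reasoning
    unchanged : ∀ x → x ≢ start C → x ≢ end C → isMissing G c′ j x ≡ isMissing G c j x
    unchanged x x≢s x≢e = case x ∈? S of λ where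
      (yes x∈) → trans (c′-j≡c-i x∈) (trans (c-i-present x∈ x≢s x≢e) (sym (c-j-present x∈)))
      (no  x∉) → isMissing-kempeSwap-∉ x∉

-- Rebalancing

RainbowOn-cong : ∀ {n k} {G : Graph n} (F : EdgeSubset G) {c c′ : Coloring n k} →
  (∀ {u w} → inF F u w ≡ true → c′ u w ≡ c u w) → RainbowOn F c → RainbowOn F c′
RainbowOn-cong F agree rainbow u v x y uv∈F xy∈F eq =
  rainbow u v x y uv∈F xy∈F (trans (sym (agree uv∈F)) (trans eq (agree xy∈F)))

module _ {n k} {G : Graph n} (F : EdgeSubset G) (c : Coloring n k) where

  coloredEdgeIn? : ∀ a → Dec (∃₂ λ x y → inF F x y ≡ true × c x y ≡ a)
  coloredEdgeIn? a = any? (λ x → any? (λ y → (inF F x y ≟ᵇ true) ×-dec (c x y ≟ a)))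

  colorWitness : Fin k → List (Fin n)
  colorWitness a with coloredEdgeIn? a
  ... | yes (x , _) = x ∷ []
  ... | no  _       = []

  length-colorWitness : ∀ a → length (colorWitness a) ≤ 1
  length-colorWitness a with coloredEdgeIn? a
  ... | yes _ = s≤s z≤n
  ... | no  _ = z≤n

  -- F being rainbow, at most one edge of F has colour a, and the witness is an end of it.
  colorWitness-avoided : ∀ {a S} → RainbowOn F c → ColorClosed G c a S →
    All (_∉ S) (colorWitness a) → ∀ {u w} → inF F u w ≡ true → u ∈ S → c u w ≢ a
  colorWitness-avoided {a} rainbow closed avoid {u} {w} uw∈F u∈ uw-a with coloredEdgeIn? a
  ... | no  ∄ = ∄ (u , w , uw∈F , uw-a)
  ... | yes (x , y , xy∈F , xy-a) with rainbow u w x y uw∈F xy∈F (trans uw-a (sym xy-a)) | avoid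
  ...   | inj₁ (refl , refl) | x∉ All.∷ _ = x∉ u∈
  ...   | inj₂ (refl , refl) | x∉ All.∷ _ = x∉ (closed u∈ (sub F u w uw∈F) uw-a)

square : ℕ → ℕ
square x = x * x

squareSum : ∀ {k} → (Fin k → ℕ) → ℕ
squareSum m = sum (square ∘ m)

square-transfer : ∀ {x y} → y < x → square x + square (y + 2) < square (x + 2) + square y
square-transfer {x} {y} y<x = begin-strict
  x * x + (y + 2) * (y + 2)  ≡⟨ expandʳ x y ⟩
  x * x + y * y + 4 + 4 * y  <⟨ +-monoʳ-< (x * x + y * y + 4) (*-monoʳ-< 4 y<x) ⟩
  x * x + y * y + 4 + 4 * x  ≡⟨ expandˡ x y ⟨
  (x + 2) * (x + 2) + y * y  ∎
  where
  open ≤-Reasoning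
  expandʳ : ∀ x y → x * x + (y + 2) * (y + 2) ≡ x * x + y * y + 4 + 4 * y
  expandʳ = solve-∀
  expandˡ : ∀ x y → (x + 2) * (x + 2) + y * y ≡ x * x + y * y + 4 + 4 * x
  expandˡ = solve-∀

squareSum-transfer : ∀ {k} {m m′ : Fin k → ℕ} {i j : Fin k} → i ≢ j →
  (∀ a → a ≢ i → a ≢ j → m′ a ≡ m a) →
  m i ≡ m′ i + 2 → m′ j ≡ m j + 2 → m j < m′ i → squareSum m′ < squareSum m
squareSum-transfer {m = m} {m′} {i} {j} i≢j unchanged mi≡ m′j≡ mj<m′i =
  +-cancelʳ-< (square (m i) + square (m j)) _ _ (begin-strict
    squareSum m′ + (square (m i) + square (m j))    ≡⟨ +-assoc (squareSum m′) _ _ ⟨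
    squareSum m′ + square (m i) + square (m j)      ≡⟨ sum-update₂ (square ∘ m′) (square ∘ m) i≢j
                                                         (λ a a≢i a≢j → cong square (unchanged a a≢i a≢j)) ⟩
    squareSum m + square (m′ i) + square (m′ j)     ≡⟨ +-assoc (squareSum m) _ _ ⟩
    squareSum m + (square (m′ i) + square (m′ j))   <⟨ +-monoʳ-< (squareSum m) transferred ⟩
    squareSum m + (square (m i) + square (m j))     ∎)
  where
  open ≤-Reasoning
  transferred : square (m′ i) + square (m′ j) < square (m i) + square (m j)
  transferred rewrite mi≡ | m′j≡ = square-transfer mj<m′i

∣-∣≤ : ∀ {m n k} → m ≤ n + k → n ≤ m + k → ∣ m - n ∣ ≤ k
∣-∣≤ {m} {n} m≤n+k n≤m+k with ∣m-n∣≡[m∸n]∨[n∸m] m n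
... | inj₁ ∣m-n∣≡m∸n = subst (_≤ _) (sym ∣m-n∣≡m∸n) (m≤n+o⇒m∸n≤o m n m≤n+k)
... | inj₂ ∣m-n∣≡n∸m = subst (_≤ _) (sym ∣m-n∣≡n∸m) (m≤n+o⇒m∸n≤o n m n≤m+k)

≰+6⇒≤+5 : ∀ {m n} → ¬ (n + 6 ≤ m) → m ≤ n + 5
≰+6⇒≤+5 {m} {n} n+6≰m = m<1+n⇒m≤n (subst (m <_) (+-suc n 5) (≰⇒> n+6≰m))

module _ {n k : ℕ} (G : Graph n) where

  potential : Coloring n k → ℕ
  potential c = squareSum (missingCount G c)

  Balanced : Coloring n k → Set
  Balanced φ = ∀ (i j : Fin k) → i ≢ j → ∣ missingCount G φ i - missingCount G φ j ∣ ≤ 5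

  module _ (F : EdgeSubset G) where

    rebalance : ∀ {c i j} → IsEdgeColoring G k c → RainbowOn F c →
      missingCount G c j + 6 ≤ missingCount G c i →
      ∃ λ c′ → IsEdgeColoring G k c′ × RainbowOn F c′ × potential c′ < potential c
    rebalance {c} {i} {j} proper rainbow gap =
      c′ , c′-isEdgeColoring , RainbowOn-cong F F-unchanged rainbow ,
      squareSum-transfer i≢j (λ _ → missingCount-kempeSwap-other) missingCount-i missingCount-j j<i′
      where
      I J : Matching n
      I = colorMatching G proper i
      J = colorMatching G proper j

      i≢j : i ≢ j
      i≢j refl = m+1+n≰m (missingCount G c i) gap

      forbidden : List (Fin n)
      forbidden = colorWitness F c i ++ colorWitness F c j

      length-forbidden : length forbidden ≤ 2
      length-forbidden = ≤-trans (≤-reflexive (length-++ (colorWitness F c i)))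
        (+-mono-≤ (length-colorWitness F c i) (length-colorWitness F c j))

      surplus : Surplus I J forbidden
      surplus = begin-strict
        unmatched J + 2 * length forbidden         ≡⟨ cong (_+ 2 * length forbidden)
                                                           (missingCount≡unmatched G proper j) ⟨
        missingCount G c j + 2 * length forbidden  ≤⟨ +-monoʳ-≤ _ (*-monoʳ-≤ 2 length-forbidden) ⟩
        missingCount G c j + 4                     <⟨ +-monoʳ-< _ (s≤s (s≤s (s≤s (s≤s (s≤s z≤n))))) ⟩
        missingCount G c j + 6                     ≤⟨ gap ⟩
        missingCount G c i                         ≡⟨ missingCount≡unmatched G proper i ⟩
        unmatched I                                ∎
        where open ≤-Reasoning

      component : AugmentingComponent I J forbidden
      component = augmentingComponent (suc (matched J)) ≤-refl surplus

      open SwapAlong G proper component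

      F-unchanged : ∀ {u w} → inF F u w ≡ true → c′ u w ≡ c u w
      F-unchanged uw∈F = kempeSwap-fixes
        (colorWitness-avoided F c rainbow closedᵢ (++⁻ˡ _ (avoids component)) uw∈F)
        (colorWitness-avoided F c rainbow closedⱼ (++⁻ʳ _ (avoids component)) uw∈F)

      j<i′ : missingCount G c j < missingCount G c′ i
      j<i′ = +-cancelʳ-< 2 _ _ (begin-strict
        missingCount G c j + 2   <⟨ +-monoʳ-< _ (s≤s (s≤s (s≤s z≤n))) ⟩
        missingCount G c j + 6   ≤⟨ gap ⟩
        missingCount G c i       ≡⟨ missingCount-i ⟩
        missingCount G c′ i + 2  ∎)
        where open ≤-Reasoning

    balance : ∀ fuel {c} → IsEdgeColoring G k c → RainbowOn F c → potential c < fuel →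
      Σ (Coloring n k) λ φ → IsEdgeColoring G k φ × RainbowOn F φ × Balanced φ
    balance (suc fuel) {c} proper rainbow c<fuel
      with any? (λ i → any? (λ j → missingCount G c j + 6 ≤? missingCount G c i))
    ... | yes (_ , _ , gap) =
      let c′ , proper′ , rainbow′ , c′<c = rebalance proper rainbow gap
      in balance fuel proper′ rainbow′ (<-≤-trans c′<c (≤-pred c<fuel))
    ... | no ∄gap = c , proper , rainbow , λ i j _ →
      ∣-∣≤ (≰+6⇒≤+5 λ gap → ∄gap (i , j , gap))
           (≰+6⇒≤+5 λ gap → ∄gap (j , i , gap))

lemma7 : ∀ {n : ℕ} (G : Graph n) (F : EdgeSubset G) (k : ℕ) →
    MaxDegree≤ G k →
    Σ (Fin n → Fin n → Fin k) (λ c → IsEdgeColoring G k c × RainbowOn F c) →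
    Σ (Fin n → Fin n → Fin k) (λ φ → IsEdgeColoring G k φ × RainbowOn F φ ×
      (∀ (i j : Fin k) → i ≢ j →
        ∣ missingCount G φ i - missingCount G φ j ∣ ≤ 5))
lemma7 G F k _ (c , proper , rainbow) = balance G F (suc (potential G c)) proper rainbow ≤-refl
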